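{- For every integer $n\ge2$, \[ \log g(n)\le\theta\big(P^{+}(g(n))\big)+S(q), \] where $q$ is the prime following $P^{+}(g(n))$ and \[ S(q)=\sum_{\alpha=2}^{\lfloor\log(2q)/\log 2\rfloor}\theta\big(q^{1/\alpha}+1\big). \]
   Context: $g(n)$ is Landau's function: $g(n)=\max\{M : \ell(M)\le n\}$ where $\ell$ is additive on coprime factors with $\ell(p^\alpha)=p^\alpha$ ($p$ prime, $\alpha\ge1$), $\ell(1)=0$ (equivalently the maximal order of an element of $\mathfrak{S}_n$). $P^{+}(M)$ is the largest prime factor of $M$. $\theta(x)=\sum_{p\le x}\log p$ (sum over primes). -}

module Defs where

open import Data.Nat using (ℕ; zero; suc; _+_; _*_; _^_; _≤_; _<_; _≤?_)
open import Data.Nat.Divisibility using (_∣_; _∣?_)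
open import Data.Nat.Primality using (Prime; prime?)
open import Data.Nat.Logarithm using (⌊log₂_⌋)
open import Data.List using (List; map; upTo; drop)
open import Data.Nat.ListAction using (sum; product)
open import Data.Bool using (Bool; if_then_else_; _∧_)
open import Data.Product using (_×_)
open import Relation.Nullary using (does)

pvAux : ℕ → ℕ → ℕ → ℕ
pvAux p M zero = zero
pvAux p M (suc k) = if does ((p ^ suc k) ∣? M) then suc k else pvAux p M k

-- p-adic valuation of M (for prime p and M ≥ 1; exponents never exceed M)
val : ℕ → ℕ → ℕ
val p M = pvAux p M M

-- ℓ(M) = Σ_{p^α ∥ M} p^α  (sum over primes p ≤ M dividing M); ℓ(1) = 0
ℓ : ℕ → ℕ
ℓ M = sum (map (λ p → if does (prime? p) ∧ does (p ∣? M) then p ^ val p M else 0)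
               (upTo (suc M)))

IsLandau : ℕ → ℕ → Set
IsLandau n G = (1 ≤ G) × (ℓ G ≤ n) × (∀ M → 1 ≤ M → ℓ M ≤ n → M ≤ G)

IsLargestPrimeFactor : ℕ → ℕ → Set
IsLargestPrimeFactor G P = Prime P × (P ∣ G) × (∀ p → Prime p → p ∣ G → p ≤ P)

IsNextPrime : ℕ → ℕ → Set
IsNextPrime P q = Prime q × (P < q) × (∀ r → Prime r → P < r → q ≤ r)

-- primorial x = ∏_{p ≤ x} p = exp(θ(x))
primorial : ℕ → ℕ
primorial x = product (map (λ p → if does (prime? p) then p else 1) (upTo (suc x)))

irootAux : ℕ → ℕ → ℕ → ℕ
irootAux α q zero = zero
irootAux α q (suc k) = if does ((suc k) ^ α ≤? q) then suc k else irootAux α q k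

iroot : ℕ → ℕ → ℕ
iroot α q = irootAux α q q

-- exp(S(q)) = ∏_{α=2}^{⌊log₂(2q)⌋} exp(θ(q^{1/α}+1)),
-- using θ(q^{1/α}+1) = θ(⌊q^{1/α}⌋+1) and ⌊log(2q)/log 2⌋ = ⌊log₂(2q)⌋
expS : ℕ → ℕ
expS q = product (map (λ α → primorial (iroot α q + 1)) (drop 2 (upTo (suc ⌊log₂ (2 * q) ⌋))))

-- Every prime power r ^ k dividing G = g(n) divides primorial P * expS q, hence G does.
-- The factor r comes from primorial P since r ≤ P. For the remaining r ^ (k - 1), compare G
-- with H q, where G = H r: its ℓ is at most ℓ(G) - r ^ a + r ^ (a - 1) + q with a the
-- r-adic valuation of G, and H q > G, so maximality of G forces (r - 1) r ^ (a - 1) < q.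
-- Hence (r - 1) ^ j ≤ q, i.e. r ≤ ⌊q^{1/j}⌋ + 1, for 2 ≤ j ≤ a, and 2 ^ a ≤ 2 q, so r divides
-- a different factor primorial (⌊q^{1/j}⌋ + 1) of expS q for each of these a - 1 values of j.
module Submission where

open import Defs
open import Data.Nat.Base
open import Data.Nat.Properties
open import Data.Nat.Divisibility
open import Data.Nat.Primality
open import Data.Nat.Logarithm using (⌊log₂_⌋; ⌊log₂⌋-mono-≤; ⌊log₂[2^n]⌋≡n)
open import Data.Nat.Primality.Factorisation using (factorise)
open import Data.Nat.Induction using (<-rec)
open import Data.Nat.ListAction using (sum; product)
open import Data.Nat.ListAction.Properties using (sum-++; ∈⇒∣product)
open import Data.List.Base using (List; []; _∷_; [_]; _++_; map; upTo; applyUpTo; drop)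
open import Data.List.Properties using (upTo-∷ʳ; map-++)
open import Data.List.Membership.Propositional.Properties using (∈-map⁺; ∈-upTo⁺)
open import Data.List.Relation.Unary.All using (_∷_)
open import Data.Bool.Base using (true; false; T; if_then_else_; _∧_)
open import Data.Empty using (⊥-elim)
open import Data.Product.Base using (∃-syntax; _×_; _,_)
open import Data.Sum.Base using (inj₁; inj₂)
open import Function.Base using (_∘_)
open import Relation.Nullary using (¬_; yes; no; does; contradiction)
open import Relation.Binary.PropositionalEquality using (_≡_; _≢_; refl; sym; trans; cong; cong₂; subst; subst₂; module ≡-Reasoning)

prime⇒≥2 : ∀ {p} → Prime p → 2 ≤ p
prime⇒≥2 {p} pr = nonTrivial⇒n>1 p {{prime⇒nonTrivial pr}}

prime∣prime⇒≡ : ∀ {p q} → Prime p → Prime q → p ∣ q → p ≡ q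
prime∣prime⇒≡ pp pq p∣q with prime⇒irreducible pq p∣q
... | inj₁ refl = contradiction (prime⇒≥2 pp) λ { (s≤s ()) }
... | inj₂ p≡q = p≡q

prime-factor : ∀ {n} → 2 ≤ n → ∃[ p ] Prime p × p ∣ n
prime-factor {n} n≥2 with factorise n {{>-nonZero (<-trans z<s n≥2)}}
... | record { factors = [] ; isFactorisation = n≡1 } = contradiction n≡1 (>⇒≢ n≥2)
... | record { factors = p ∷ ps ; isFactorisation = n≡pΠ ; factorsPrime = pr ∷ _ } =
  p , pr , divides (product ps) (trans n≡pΠ (*-comm p (product ps)))

prime^∣*∤⇒∣ : ∀ {p m n} → Prime p → ¬ p ∣ n → ∀ v → p ^ v ∣ m * n → p ^ v ∣ m
prime^∣*∤⇒∣ {p} {m} pr p∤n zero _ = 1∣ m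
prime^∣*∤⇒∣ {p} {m} {n} pr p∤n (suc v) pᵛ⁺¹∣mn
  with euclidsLemma m n pr (m*n∣⇒m∣ p (p ^ v) pᵛ⁺¹∣mn)
... | inj₂ p∣n = contradiction p∣n p∤n
... | inj₁ (divides m′ refl) =
  subst (p * p ^ v ∣_) (*-comm p m′) (*-monoʳ-∣ p (prime^∣*∤⇒∣ pr p∤n v pᵛ∣m′n))
  where
    instance _ = prime⇒nonZero pr
    pᵛ∣m′n : p ^ v ∣ m′ * n
    pᵛ∣m′n = *-cancelˡ-∣ p (subst (p * p ^ v ∣_) m′pn≡p[m′n] pᵛ⁺¹∣mn)
      where
        m′pn≡p[m′n] : m′ * p * n ≡ p * (m′ * n)
        m′pn≡p[m′n] = trans (cong (_* n) (*-comm m′ p)) (*-assoc p m′ n)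

prime^∣∧∣⇒*∣ : ∀ {r a H X} → Prime r → ¬ r ∣ H → r ^ a ∣ X → H ∣ X → H * r ^ a ∣ X
prime^∣∧∣⇒*∣ {r} {a} {H} pr r∤H rᵃ∣X (divides Y X≡YH) =
  subst (H * r ^ a ∣_) (trans (*-comm H Y) (sym X≡YH)) (*-monoʳ-∣ H rᵃ∣Y)
  where
    rᵃ∣Y : r ^ a ∣ Y
    rᵃ∣Y = prime^∣*∤⇒∣ pr r∤H a (subst (r ^ a ∣_) X≡YH rᵃ∣X)

n<2^n : ∀ n → n < 2 ^ n
n<2^n zero = z<s
n<2^n (suc n) = begin-strict
  suc n          ≤⟨ n<2^n n ⟩
  2 ^ n          <⟨ m<m+n (2 ^ n) (m^n>0 2 n) ⟩
  2 ^ n + 2 ^ n  ≡⟨ cong (2 ^ n +_) (+-identityʳ (2 ^ n)) ⟨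
  2 ^ suc n      ∎
  where open ≤-Reasoning

m≤m^n : ∀ m {n} → 1 ≤ n → m ≤ m ^ n
m≤m^n zero _ = z≤n
m≤m^n (suc m) {suc n} _ = m≤m*n (suc m) (suc m ^ n) {{m^n≢0 (suc m) n}}

pow∣⇒≤ : ∀ {p j M} → 2 ≤ p → 1 ≤ M → p ^ j ∣ M → j ≤ M
pow∣⇒≤ {p} {j} {M} p≥2 M≥1 pʲ∣M = <⇒≤ (begin-strict
  j      <⟨ n<2^n j ⟩
  2 ^ j  ≤⟨ ^-monoˡ-≤ j p≥2 ⟩
  p ^ j  ≤⟨ ∣⇒≤ {{>-nonZero M≥1}} pʲ∣M ⟩
  M      ∎)
  where open ≤-Reasoning

pvAux-∣ : ∀ p M k → p ^ pvAux p M k ∣ M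
pvAux-∣ p M zero = 1∣ M
pvAux-∣ p M (suc k) with (p ^ suc k) ∣? M
... | yes pᵏ⁺¹∣M = pᵏ⁺¹∣M
... | no _ = pvAux-∣ p M k

pvAux-maximal : ∀ {p M j} k → j ≤ k → p ^ j ∣ M → j ≤ pvAux p M k
pvAux-maximal zero j≤0 _ = j≤0
pvAux-maximal {p} {M} (suc k) j≤k+1 pʲ∣M with (p ^ suc k) ∣? M
... | yes _ = j≤k+1
... | no pᵏ⁺¹∤M with m≤n⇒m<n∨m≡n j≤k+1
...   | inj₁ j<k+1 = pvAux-maximal k (≤-pred j<k+1) pʲ∣M
...   | inj₂ refl = contradiction pʲ∣M pᵏ⁺¹∤M

pow-val∣ : ∀ p M → p ^ val p M ∣ M
pow-val∣ p M = pvAux-∣ p M M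

pow∣⇒≤val : ∀ {p M j} → Prime p → 1 ≤ M → p ^ j ∣ M → j ≤ val p M
pow∣⇒≤val pr M≥1 pʲ∣M = pvAux-maximal _ (pow∣⇒≤ (prime⇒≥2 pr) M≥1 pʲ∣M) pʲ∣M

prime-powers∣⇒∣ : ∀ {X} G → 1 ≤ G → (∀ r k → Prime r → r ^ k ∣ G → r ^ k ∣ X) → G ∣ X
prime-powers∣⇒∣ {X} = <-rec _ step
  where
    PrimePowersDivide : ℕ → Set
    PrimePowersDivide G = ∀ r k → Prime r → r ^ k ∣ G → r ^ k ∣ X

    step : ∀ G → (∀ {H} → H < G → 1 ≤ H → PrimePowersDivide H → H ∣ X)
         → 1 ≤ G → PrimePowersDivide G → G ∣ X
    step 1 _ _ _ = 1∣ X
    step G@(suc (suc _)) ind G≥1 pow∣X with prime-factor {G} (s≤s (s≤s z≤n))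
    ... | r , pr , r∣G with pow-val∣ r G
    ...   | divides H G≡Hrᵃ =
      subst (_∣ X) (sym G≡Hrᵃ) (prime^∣∧∣⇒*∣ {a = a} pr r∤H (pow∣X r a pr (pow-val∣ r G)) H∣X)
      where
        a : ℕ
        a = val r G
        instance
          r≢0 : NonZero r
          r≢0 = prime⇒nonZero pr
          H≢0 : NonZero H
          H≢0 = m*n≢0⇒m≢0 H {{subst NonZero G≡Hrᵃ _}}
        r∤H : ¬ r ∣ H
        r∤H r∣H = <-irrefl refl (pow∣⇒≤val pr G≥1 rᵃ⁺¹∣G)
          where
            rᵃ⁺¹∣G : r * r ^ a ∣ G
            rᵃ⁺¹∣G = subst (r * r ^ a ∣_) (sym G≡Hrᵃ) (*-monoˡ-∣ (r ^ a) r∣H)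
        H<G : H < G
        H<G = subst (H <_) (sym G≡Hrᵃ) (m<m*n H (r ^ a) (≤-trans (prime⇒≥2 pr) rᵃ≥r))
          where
            rᵃ≥r : r ≤ r ^ a
            rᵃ≥r = m≤m^n r (pow∣⇒≤val pr G≥1 (subst (_∣ G) (sym (*-identityʳ r)) r∣G))
        H∣X : H ∣ X
        H∣X = ind H<G (>-nonZero⁻¹ H) λ s k ps sᵏ∣H →
                pow∣X s k ps (∣-trans sᵏ∣H (divides (r ^ a) (trans G≡Hrᵃ (*-comm H (r ^ a)))))

irootAux-maximal : ∀ {j q m} k → m ≤ k → m ^ j ≤ q → m ≤ irootAux j q k
irootAux-maximal zero m≤0 _ = m≤0
irootAux-maximal {j} {q} (suc k) m≤k+1 mʲ≤q with suc k ^ j ≤ᵇ q in kʲ≤ᵇq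
... | true = m≤k+1
... | false with m≤n⇒m<n∨m≡n m≤k+1
...   | inj₁ m<k+1 = irootAux-maximal k (≤-pred m<k+1) mʲ≤q
...   | inj₂ refl = ⊥-elim (subst T kʲ≤ᵇq (≤⇒≤ᵇ mʲ≤q))

≤-iroot : ∀ {j q m} → 1 ≤ j → m ^ j ≤ q → m ≤ iroot j q
≤-iroot {m = m} j≥1 mʲ≤q = irootAux-maximal _ (≤-trans (m≤m^n m j≥1) mʲ≤q) mʲ≤q

product-map≢0 : ∀ (f : ℕ → ℕ) xs → (∀ x → NonZero (f x)) → NonZero (product (map f xs))
product-map≢0 f [] _ = _
product-map≢0 f (x ∷ xs) f≢0 = m*n≢0 (f x) _ {{f≢0 x}} {{product-map≢0 f xs f≢0}}

primorial≢0 : ∀ x → NonZero (primorial x)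
primorial≢0 x = product-map≢0 _ (upTo (suc x)) prime-or-1≢0
  where
    prime-or-1≢0 : ∀ p → NonZero (if does (prime? p) then p else 1)
    prime-or-1≢0 p with prime? p
    ... | yes pr = prime⇒nonZero pr
    ... | no _ = _

expS≢0 : ∀ q → NonZero (expS q)
expS≢0 q = product-map≢0 _ (drop 2 (upTo (suc ⌊log₂ (2 * q) ⌋))) λ α → primorial≢0 (iroot α q + 1)

prime∣primorial : ∀ {r x} → Prime r → r ≤ x → r ∣ primorial x
prime∣primorial {r} {x} pr r≤x =
  subst (_∣ primorial x) prime-kept (∈⇒∣product (∈-map⁺ _ (∈-upTo⁺ (s≤s r≤x))))
  where
    prime-kept : (if does (prime? r) then r else 1) ≡ r
    prime-kept with prime? r
    ... | yes _ = refl
    ... | no ¬pr = contradiction pr ¬pr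

pow∣product-applyUpTo : ∀ (F g : ℕ → ℕ) {r k L} → k ≤ L → (∀ i → i < k → r ∣ F (g i))
                      → r ^ k ∣ product (map F (applyUpTo g L))
pow∣product-applyUpTo F g {k = zero} _ _ = 1∣ _
pow∣product-applyUpTo F g {k = suc k} {suc L} (s≤s k≤L) r∣F∘g =
  *-pres-∣ (r∣F∘g 0 z<s) (pow∣product-applyUpTo F (g ∘ suc) k≤L λ i i<k → r∣F∘g (suc i) (s<s i<k))

-- drop 2 (upTo (2 + L)) is definitionally applyUpTo (2 +_) L.
pow∣product-drop2-upTo : ∀ (F : ℕ → ℕ) {r k L} → suc k ≤ L → (∀ j → 2 ≤ j → j ≤ suc k → r ∣ F j)
                       → r ^ k ∣ product (map F (drop 2 (upTo (suc L))))
pow∣product-drop2-upTo F {L = suc L} (s≤s k≤L) r∣F =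
  pow∣product-applyUpTo F (suc ∘ suc) k≤L λ i i<k → r∣F (2 + i) (s≤s (s≤s z≤n)) (s≤s i<k)

-- ℓ M is definitionally sum (map (ℓ-term M) (upTo (suc M))).
ℓ-term : ℕ → ℕ → ℕ
ℓ-term M s = if does (prime? s) ∧ does (s ∣? M) then s ^ val s M else 0

ℓ-term-≤ : ∀ {M s b} → (Prime s → s ∣ M → s ^ val s M ≤ b) → ℓ-term M s ≤ b
ℓ-term-≤ {M} {s} bound with prime? s | s ∣? M
... | yes ps | yes s∣M = bound ps s∣M
... | yes _ | no _ = z≤n
... | no _ | _ = z≤n

ℓ-term-prime∣ : ∀ {M s} → Prime s → s ∣ M → ℓ-term M s ≡ s ^ val s M
ℓ-term-prime∣ {M} {s} ps s∣M with prime? s | s ∣? M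
... | yes _ | yes _ = refl
... | yes _ | no s∤M = contradiction s∣M s∤M
... | no ¬ps | _ = contradiction ps ¬ps

ℓ-term-∤ : ∀ {M s} → ¬ s ∣ M → ℓ-term M s ≡ 0
ℓ-term-∤ {M} {s} s∤M with prime? s | s ∣? M
... | yes _ | yes s∣M = contradiction s∣M s∤M
... | yes _ | no _ = refl
... | no _ | _ = refl

sum-map-upTo-suc : ∀ (f : ℕ → ℕ) N → sum (map f (upTo (suc N))) ≡ sum (map f (upTo N)) + f N
sum-map-upTo-suc f N = begin
  sum (map f (upTo (suc N)))          ≡⟨ cong (sum ∘ map f) (upTo-∷ʳ N) ⟨
  sum (map f (upTo N ++ [ N ]))       ≡⟨ cong sum (map-++ f (upTo N) [ N ]) ⟩
  sum (map f (upTo N) ++ [ f N ])     ≡⟨ sum-++ (map f (upTo N)) [ f N ] ⟩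
  sum (map f (upTo N)) + (f N + 0)    ≡⟨ cong (sum (map f (upTo N)) +_) (+-identityʳ (f N)) ⟩
  sum (map f (upTo N)) + f N          ∎
  where open ≡-Reasoning

sum-map-upTo-vanishing : ∀ (f : ℕ → ℕ) {N N′} → N ≤ N′ → (∀ i → N ≤ i → i < N′ → f i ≡ 0)
                       → sum (map f (upTo N′)) ≡ sum (map f (upTo N))
sum-map-upTo-vanishing f {N′ = zero} z≤n _ = refl
sum-map-upTo-vanishing f {N} {suc N′} N≤N′+1 f≡0 with m≤n⇒m<n∨m≡n N≤N′+1
... | inj₂ refl = refl
... | inj₁ N<N′+1 = begin
  sum (map f (upTo (suc N′)))   ≡⟨ sum-map-upTo-suc f N′ ⟩
  sum (map f (upTo N′)) + f N′
    ≡⟨ cong₂ _+_ (sum-map-upTo-vanishing f N≤N′ f≡0′) (f≡0 N′ N≤N′ ≤-refl) ⟩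
  sum (map f (upTo N)) + 0      ≡⟨ +-identityʳ _ ⟩
  sum (map f (upTo N))          ∎
  where
    open ≡-Reasoning
    N≤N′ : N ≤ N′
    N≤N′ = ≤-pred N<N′+1
    f≡0′ : ∀ i → N ≤ i → i < N′ → f i ≡ 0
    f≡0′ i N≤i i<N′ = f≡0 i N≤i (m<n⇒m<1+n i<N′)

sum-map-+ : ∀ (f g : ℕ → ℕ) xs → sum (map (λ s → f s + g s) xs) ≡ sum (map f xs) + sum (map g xs)
sum-map-+ f g [] = refl
sum-map-+ f g (x ∷ xs) = begin
  (f x + g x) + sum (map (λ s → f s + g s) xs)  ≡⟨ cong (f x + g x +_) (sum-map-+ f g xs) ⟩
  (f x + g x) + (Σf + Σg)                       ≡⟨ +-assoc (f x) (g x) (Σf + Σg) ⟩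
  f x + (g x + (Σf + Σg))                       ≡⟨ cong (f x +_) (x+[y+z]≡y+[x+z] (g x) Σf Σg) ⟩
  f x + (Σf + (g x + Σg))                       ≡⟨ +-assoc (f x) Σf (g x + Σg) ⟨
  (f x + Σf) + (g x + Σg)                       ∎
  where
    open ≡-Reasoning
    Σf = sum (map f xs)
    Σg = sum (map g xs)
    x+[y+z]≡y+[x+z] : ∀ x y z → x + (y + z) ≡ y + (x + z)
    x+[y+z]≡y+[x+z] x y z = trans (sym (+-assoc x y z)) (trans (cong (_+ z) (+-comm x y)) (+-assoc y x z))

sum-map-mono-≤ : ∀ {f g : ℕ → ℕ} xs → (∀ x → f x ≤ g x) → sum (map f xs) ≤ sum (map g xs)
sum-map-mono-≤ [] _ = z≤n
sum-map-mono-≤ (x ∷ xs) f≤g = +-mono-≤ (f≤g x) (sum-map-mono-≤ xs f≤g)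

δ : ℕ → ℕ → ℕ → ℕ
δ r c s = if s ≡ᵇ r then c else 0

δ-same : ∀ r c → δ r c r ≡ c
δ-same r c with r ≡ᵇ r in r≡ᵇr
... | true = refl
... | false = ⊥-elim (subst T r≡ᵇr (≡⇒≡ᵇ r r refl))

δ-other : ∀ {r s} c → s ≢ r → δ r c s ≡ 0
δ-other {r} {s} c s≢r with s ≡ᵇ r in s≡ᵇr
... | true = contradiction (≡ᵇ⇒≡ s r (subst T (sym s≡ᵇr) _)) s≢r
... | false = refl

sum-δ : ∀ {r N} c → r < N → sum (map (δ r c) (upTo N)) ≡ c
sum-δ {r} {N} c r<N = begin
  sum (map (δ r c) (upTo N))
    ≡⟨ sum-map-upTo-vanishing (δ r c) r<N (λ i r<i _ → δ-other c (>⇒≢ r<i)) ⟩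
  sum (map (δ r c) (upTo (suc r)))
    ≡⟨ sum-map-upTo-suc (δ r c) r ⟩
  sum (map (δ r c) (upTo r)) + δ r c r
    ≡⟨ cong₂ _+_ (sum-map-upTo-vanishing (δ r c) z≤n (λ i _ i<r → δ-other c (<⇒≢ i<r))) (δ-same r c) ⟩
  c
    ∎
  where open ≡-Reasoning

ℓ-upTo : ∀ {M N} → 1 ≤ M → M ≤ N → sum (map (ℓ-term M) (upTo (suc N))) ≡ ℓ M
ℓ-upTo {M} M≥1 M≤N = sum-map-upTo-vanishing (ℓ-term M) (s≤s M≤N) λ i M<i _ →
  ℓ-term-∤ λ i∣M → <⇒≱ M<i (∣⇒≤ {{>-nonZero M≥1}} i∣M)

module Exchange {G H r q : ℕ} (G≥1 : 1 ≤ G) (G≡Hr : G ≡ H * r) (prime-r : Prime r) (prime-q : Prime q)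
                (r<q : r < q) (q∤G : ¬ q ∣ G) where

  a : ℕ
  a = val r G

  instance
    r≢0 : NonZero r
    r≢0 = prime⇒nonZero prime-r
    q≢0 : NonZero q
    q≢0 = prime⇒nonZero prime-q
    H≢0 : NonZero H
    H≢0 = m*n≢0⇒m≢0 H {{subst NonZero G≡Hr (>-nonZero G≥1)}}

  H∣G : H ∣ G
  H∣G = divides r (trans G≡Hr (*-comm H r))

  G≤Hq : G ≤ H * q
  G≤Hq = subst (_≤ H * q) (sym G≡Hr) (*-monoʳ-≤ H (<⇒≤ r<q))

  pow∣Hq⇒pow∣H : ∀ {s} v → Prime s → s ≢ q → s ^ v ∣ H * q → s ^ v ∣ H
  pow∣Hq⇒pow∣H v ps s≢q = prime^∣*∤⇒∣ ps (s≢q ∘ prime∣prime⇒≡ ps prime-q) v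

  prime∣Hq⇒∣G : ∀ {s} → Prime s → s ≢ q → s ∣ H * q → s ∣ G
  prime∣Hq⇒∣G ps s≢q s∣Hq with euclidsLemma H _ ps s∣Hq
  ... | inj₁ s∣H = ∣-trans s∣H H∣G
  ... | inj₂ s∣q = contradiction (prime∣prime⇒≡ ps prime-q s∣q) s≢q

  ℓ-term-r : ℓ-term (H * q) r ≤ r ^ (a ∸ 1)
  ℓ-term-r = ℓ-term-≤ {H * q} {r} λ _ _ → ^-monoʳ-≤ r v≤a-1
    where
      v : ℕ
      v = val r (H * q)
      rᵛ⁺¹∣G : r ^ suc v ∣ G
      rᵛ⁺¹∣G = subst₂ _∣_ (*-comm (r ^ v) r) (sym G≡Hr)
                 (*-monoˡ-∣ r (pow∣Hq⇒pow∣H v prime-r (<⇒≢ r<q) (pow-val∣ r (H * q))))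
      v≤a-1 : v ≤ a ∸ 1
      v≤a-1 = ∸-monoˡ-≤ 1 (pow∣⇒≤val prime-r G≥1 rᵛ⁺¹∣G)

  ℓ-term-q : ℓ-term (H * q) q ≤ q
  ℓ-term-q = ℓ-term-≤ {H * q} {q} λ _ _ → q-part (val q (H * q)) (pow-val∣ q (H * q))
    where
      q-part : ∀ v → q ^ v ∣ H * q → q ^ v ≤ q
      q-part zero _ = >-nonZero⁻¹ q
      q-part (suc zero) _ = ≤-reflexive (*-identityʳ q)
      q-part (suc (suc w)) qʷ⁺²∣Hq = contradiction (∣-trans q∣H H∣G) q∤G
        where
          q∣H : q ∣ H
          q∣H = m*n∣⇒m∣ q (q ^ w) (*-cancelʳ-∣ q (subst (_∣ H * q) (*-comm q (q ^ suc w)) qʷ⁺²∣Hq))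

  ℓ-term-other : ∀ {s} → s ≢ q → ℓ-term (H * q) s ≤ ℓ-term G s
  ℓ-term-other {s} s≢q = ℓ-term-≤ {H * q} {s} λ ps s∣Hq →
    subst (s ^ val s (H * q) ≤_) (sym (ℓ-term-prime∣ ps (prime∣Hq⇒∣G ps s≢q s∣Hq)))
      (^-monoʳ-≤ s {{prime⇒nonZero ps}} (v≤val-G ps))
    where
      v≤val-G : Prime s → val s (H * q) ≤ val s G
      v≤val-G ps = pow∣⇒≤val ps G≥1
        (∣-trans (pow∣Hq⇒pow∣H (val s (H * q)) ps s≢q (pow-val∣ s (H * q))) H∣G)

  pointwise : ∀ s → ℓ-term (H * q) s + δ r (r ^ a) s ≤ ℓ-term G s + (δ r (r ^ (a ∸ 1)) s + δ q q s)
  pointwise s with s ≟ r | s ≟ q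
  ... | yes refl | _
    rewrite δ-same r (r ^ a) | δ-same r (r ^ (a ∸ 1)) | δ-other q (<⇒≢ r<q)
          | ℓ-term-prime∣ prime-r (divides H G≡Hr) | +-identityʳ (r ^ (a ∸ 1))
    = subst (_≤ r ^ a + r ^ (a ∸ 1)) (+-comm (r ^ a) _) (+-monoʳ-≤ (r ^ a) ℓ-term-r)
  ... | no s≢r | yes refl
    rewrite δ-other (r ^ a) s≢r | δ-other (r ^ (a ∸ 1)) s≢r | δ-same q q | ℓ-term-∤ q∤G
          | +-identityʳ (ℓ-term (H * q) q)
    = ℓ-term-q
  ... | no s≢r | no s≢q
    rewrite δ-other (r ^ a) s≢r | δ-other (r ^ (a ∸ 1)) s≢r | δ-other q s≢q
          | +-identityʳ (ℓ-term (H * q) s) | +-identityʳ (ℓ-term G s)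
    = ℓ-term-other s≢q

  ℓ-exchange : ℓ (H * q) + r ^ a ≤ ℓ G + (r ^ (a ∸ 1) + q)
  ℓ-exchange = begin
    ℓ (H * q) + r ^ a
      ≡⟨ cong (ℓ (H * q) +_) (sum-δ (r ^ a) r<N) ⟨
    Σ (ℓ-term (H * q)) + Σ (δ r (r ^ a))
      ≡⟨ sum-map-+ (ℓ-term (H * q)) (δ r (r ^ a)) xs ⟨
    Σ (λ s → ℓ-term (H * q) s + δ r (r ^ a) s)
      ≤⟨ sum-map-mono-≤ xs pointwise ⟩
    Σ (λ s → ℓ-term G s + (δ r (r ^ (a ∸ 1)) s + δ q q s))
      ≡⟨ sum-map-+ (ℓ-term G) _ xs ⟩
    Σ (ℓ-term G) + Σ (λ s → δ r (r ^ (a ∸ 1)) s + δ q q s)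
      ≡⟨ cong₂ _+_ (ℓ-upTo G≥1 G≤Hq) (sum-map-+ (δ r (r ^ (a ∸ 1))) (δ q q) xs) ⟩
    ℓ G + (Σ (δ r (r ^ (a ∸ 1))) + Σ (δ q q))
      ≡⟨ cong (ℓ G +_) (cong₂ _+_ (sum-δ (r ^ (a ∸ 1)) r<N) (sum-δ q q<N)) ⟩
    ℓ G + (r ^ (a ∸ 1) + q)
      ∎
    where
      open ≤-Reasoning
      xs : List ℕ
      xs = upTo (suc (H * q))
      Σ : (ℕ → ℕ) → ℕ
      Σ f = sum (map f xs)
      q<N : q < suc (H * q)
      q<N = s≤s (m≤n*m q H)
      r<N : r < suc (H * q)
      r<N = <-trans r<q q<N

landau-val-bound : ∀ {n G r q} → IsLandau n G → Prime r → r ∣ G → Prime q → r < q → ¬ q ∣ G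
                 → r ^ val r G < r ^ (val r G ∸ 1) + q
landau-val-bound {G = G} {r} {q} (G≥1 , ℓG≤n , maximal) prime-r (divides H G≡Hr) prime-q r<q q∤G =
  ≰⇒> exchange-fails
  where
    open Exchange {H = H} G≥1 G≡Hr prime-r prime-q r<q q∤G
    exchange-fails : ¬ r ^ (a ∸ 1) + q ≤ r ^ a
    exchange-fails room = <⇒≱ r<q (*-cancelˡ-≤ H (subst (H * q ≤_) G≡Hr Hq≤G))
      where
        ℓHq≤ℓG : ℓ (H * q) ≤ ℓ G
        ℓHq≤ℓG = +-cancelʳ-≤ (r ^ a) (ℓ (H * q)) (ℓ G) (≤-trans ℓ-exchange (+-monoʳ-≤ (ℓ G) room))
        Hq≤G : H * q ≤ G
        Hq≤G = maximal (H * q) (>-nonZero⁻¹ (H * q) {{m*n≢0 H q}}) (≤-trans ℓHq≤ℓG ℓG≤n)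

pred-*-pow< : ∀ {r a k q} → 1 ≤ r → suc k ≤ a → r ^ a < r ^ (a ∸ 1) + q → (r ∸ 1) * r ^ k < q
pred-*-pow< {suc m} {suc b} {k} (s≤s _) (s≤s k≤b) rᵃ<rᵇ+q =
  ≤-<-trans (*-monoʳ-≤ m (^-monoʳ-≤ (suc m) k≤b)) (+-cancelˡ-< (suc m ^ b) _ _ rᵃ<rᵇ+q)

pow∣expS : ∀ {r k q} → Prime r → (r ∸ 1) * r ^ k < q → r ^ k ∣ expS q
pow∣expS {r} {k} {q} prime-r bound = pow∣product-drop2-upTo _ k+1≤log₂2q r∣factor
  where
    instance
      r≢0 : NonZero r
      r≢0 = prime⇒nonZero prime-r
      r-1≢0 : NonZero (r ∸ 1)
      r-1≢0 = >-nonZero (∸-monoˡ-≤ 1 (prime⇒≥2 prime-r))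
    rᵏ≤q : r ^ k ≤ q
    rᵏ≤q = <⇒≤ (≤-<-trans (m≤n*m (r ^ k) (r ∸ 1)) bound)
    k+1≤log₂2q : suc k ≤ ⌊log₂ (2 * q) ⌋
    k+1≤log₂2q = subst (_≤ ⌊log₂ (2 * q) ⌋) (⌊log₂[2^n]⌋≡n (suc k))
                   (⌊log₂⌋-mono-≤ (*-monoʳ-≤ 2 (≤-trans (^-monoˡ-≤ k (prime⇒≥2 prime-r)) rᵏ≤q)))
    [r-1]ʲ≤q : ∀ j → j ≤ suc k → (r ∸ 1) ^ j ≤ q
    [r-1]ʲ≤q j j≤k+1 = begin
      (r ∸ 1) ^ j            ≤⟨ ^-monoʳ-≤ (r ∸ 1) j≤k+1 ⟩
      (r ∸ 1) * (r ∸ 1) ^ k  ≤⟨ *-monoʳ-≤ (r ∸ 1) (^-monoˡ-≤ k (m∸n≤m r 1)) ⟩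
      (r ∸ 1) * r ^ k        ≤⟨ <⇒≤ bound ⟩
      q                      ∎
      where open ≤-Reasoning
    r∣factor : ∀ j → 2 ≤ j → j ≤ suc k → r ∣ primorial (iroot j q + 1)
    r∣factor j j≥2 j≤k+1 = prime∣primorial prime-r
      (subst (_≤ iroot j q + 1) (m∸n+n≡m (<⇒≤ (prime⇒≥2 prime-r)))
        (+-monoˡ-≤ 1 (≤-iroot (<⇒≤ j≥2) ([r-1]ʲ≤q j j≤k+1))))

mainTheorem16 : ∀ n → 2 ≤ n → ∀ G P q → IsLandau n G → IsLargestPrimeFactor G P → IsNextPrime P q
                  → G ≤ primorial P * expS q
mainTheorem16 n _ G P q landau@(G≥1 , _) (_ , _ , ≤P) (prime-q , P<q , _) =
  ∣⇒≤ {{m*n≢0 _ _ {{primorial≢0 P}} {{expS≢0 q}}}} (prime-powers∣⇒∣ G G≥1 prime-power∣)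
  where
    q∤G : ¬ q ∣ G
    q∤G q∣G = <⇒≱ P<q (≤P q prime-q q∣G)
    prime-power∣ : ∀ r k → Prime r → r ^ k ∣ G → r ^ k ∣ primorial P * expS q
    prime-power∣ r zero _ _ = 1∣ _
    prime-power∣ r (suc k) prime-r rᵏ⁺¹∣G =
      *-pres-∣ (prime∣primorial prime-r r≤P) (pow∣expS {k = k} prime-r bound)
      where
        r∣G : r ∣ G
        r∣G = m*n∣⇒m∣ r (r ^ k) rᵏ⁺¹∣G
        r≤P : r ≤ P
        r≤P = ≤P r prime-r r∣G
        bound : (r ∸ 1) * r ^ k < q
        bound = pred-*-pow< {k = k} (<⇒≤ (prime⇒≥2 prime-r)) (pow∣⇒≤val prime-r G≥1 rᵏ⁺¹∣G)
                  (landau-val-bound landau prime-r r∣G prime-q (≤-<-trans r≤P P<q) q∤G)
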